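{- Let $(\mathcal{L},\mathcal{G})$ be an irreducible built lattice. For every $G\in\mathcal{G}\setminus\{\hat1\}$ let $\mathrm{FY}(\{G\}):\mathrm{FY}(\mathcal{L},\mathcal{G})\to\mathrm{FY}([G,\hat1],\mathrm{Ind}(\mathcal{G}))\otimes\mathrm{FY}([\hat0,G],\mathrm{Ind}(\mathcal{G}))$ be the ring homomorphism given by $h_{G'}\mapsto 1\otimes h_{G'}$ if $G'\le G$ and $h_{G'}\mapsto h_{G\vee G'}\otimes1$ otherwise. Then: (1) for $G_1<G_2<\hat1$ in $\mathcal{G}$, $(\mathrm{FY}(\{G_2\})\otimes\mathrm{Id})\circ\mathrm{FY}(\{G_1\})=(\mathrm{Id}\otimes\mathrm{FY}(\{G_1\}))\circ\mathrm{FY}(\{G_2\})$ as maps to $\mathrm{FY}([G_2,\hat1])\otimes\mathrm{FY}([G_1,G_2])\otimes\mathrm{FY}([\hat0,G_1])$ (on the left, $\mathrm{FY}(\{G_2\})$ is taken in the built lattice $([G_1,\hat1],\mathrm{Ind}(\mathcal{G}))$, in which $G_2\in\mathrm{Ind}(\mathcal{G})$; on the right, $\mathrm{FY}(\{G_1\})$ is taken in $([\hat0,G_2],\mathrm{Ind}(\mathcal{G}))$); (2) for incomparable $G_1,G_2\in\mathcal{G}\setminus\{\hat1\}$ with $\{G_1,G_2\}$ nested, $(\mathrm{FY}(\{G_1\vee G_2\})\otimes\mathrm{Id})\circ\mathrm{FY}(\{G_1\})=\sigma_{2,3}\circ(\mathrm{FY}(\{G_1\vee G_2\})\otimes\mathrm{Id})\circ\mathrm{FY}(\{G_2\})$,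 where $\sigma_{2,3}$ swaps the last two tensor factors, and where $\mathrm{FY}([G_1,G_1\vee G_2],\mathrm{Ind}(\mathcal{G}))$ is identified with $\mathrm{FY}([\hat0,G_2],\mathrm{Ind}(\mathcal{G}))$ (and symmetrically for $G_1,G_2$ exchanged) via the built-lattice isomorphism $[\hat0,G_2]\to[G_1,G_1\vee G_2]$, $X\mapsto X\vee G_1$; (3) for every poset isomorphism $f:\mathcal{L}\to\mathcal{L}'$ with $f(\mathcal{G})=\mathcal{G}'$ and every $G\in\mathcal{G}\setminus\{\hat1\}$, writing $\varphi_f$ for the ring isomorphism $h_K\mapsto h_{f(K)}$ (and similarly for restrictions of $f$ to intervals), one has $\mathrm{FY}(\{f(G)\})\circ\varphi_f=(\varphi_{f|_{[G,\hat1]}}\otimes\varphi_{f|_{[\hat0,G]}})\circ\mathrm{FY}(\{G\})$.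
   Context: Geometric lattice: finite lattice with bottom $\hat0$, top $\hat1$, all maximal chains between comparable elements of equal length, submodular rank, every element a join of atoms. A building set of $\mathcal{L}$ is $\mathcal{G}\subset\mathcal{L}\setminus\{\hat0\}$ such that for every $X$, with $\mathrm{Fact}_{\mathcal{G}}(X)$ the maximal elements of $\mathcal{G}\cap[\hat0,X]$, the join map $\prod_{G\in\mathrm{Fact}_{\mathcal{G}}(X)}[\hat0,G]\to[\hat0,X]$ is a poset isomorphism; $(\mathcal{L},\mathcal{G})$ is a built lattice, irreducible if $\hat1\in\mathcal{G}$. For $G_1<G_2$, $\mathrm{Ind}_{[G_1,G_2]}(\mathcal{G})=\big(\{G_1\vee F:F\in\mathcal{G}\}\cap[G_1,G_2]\big)\setminus\{G_1\}$, a building set of $[G_1,G_2]$; iterated induction agrees with direct induction. A subset $\mathcal{S}\subset\mathcal{G}$ is nested if no antichain $\mathcal{A}\subset\mathcal{S}$ with $|\mathcal{A}|\ge2$ has $\bigvee\mathcal{A}\in\mathcal{G}$. For an irreducible built lattice, $\mathrm{FY}(\mathcal{L},\mathcal{G})=\mathbb{Z}[h_G:G\in\mathcal{G}]/\mathcal{I}$ (generators of degree $2$), with $\mathcal{I}$ generated by $h_H$ for atoms $H$ and by $\prod_{G'\in\mathcal{A}}(h_G-h_{G'})$ for every $G\in\mathcal{G}$ and antichain $\mathcal{A}\subset\mathcal{G}$ with $\bigvee\mathcal{A}=G$. The maps $\mathrm{FY}(\{G\})$ above are well-defined ring homomorphisms. -}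

module Defs where

open import Level using (0ℓ)
open import Data.Nat as ℕ using (ℕ; zero; suc; _+_)
open import Data.Integer as ℤ using (ℤ)
open import Data.Fin using (Fin)
open import Data.Fin.Properties using (any?; _≟_)
open import Data.Fin.Subset using (Subset; _∈_; _∉_)
open import Data.Fin.Subset.Properties using (_∈?_)
open import Data.List using (List; []; _∷_; foldr; map; length)
open import Data.List.Relation.Unary.All using (All; []; _∷_)
open import Data.List.Relation.Unary.AllPairs using (AllPairs)
open import Data.List.Relation.Unary.Unique.Propositional using (Unique)
import Data.List.Membership.Propositional as LMem
open import Data.List.Relation.Binary.Subset.Propositional using (_⊆_)
open import Data.Product using (Σ; ∃; _×_; _,_; proj₁; proj₂)
open import Data.Sum using (_⊎_; inj₁; inj₂; [_,_])
open import Data.Unit using (⊤; tt)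
open import Function using (_∘_)
open import Function.Bundles using (_⇔_)
open import Relation.Binary.Core renaming (Rel to BinRel) using ()
open import Relation.Binary.Definitions using (Decidable)
open import Relation.Binary.PropositionalEquality using (_≡_; _≢_)
open import Relation.Binary.Lattice.Structures using (IsBoundedLattice)
open import Relation.Nullary using (¬_; Dec; yes; no)
open import Relation.Nullary.Decidable using (_×-dec_; ¬?)

-- The ring
-- presented by P is  ℤ[Gen P] / (Rel P) ; we realise it as the type of
-- polynomial expressions modulo the least congruence  _≈[ P ]_  that
-- contains the commutative ring axioms, makes  con : ℤ → Expr  a ring
-- homomorphism and kills every relation.

infixl 6 _⊕_
infixl 7 _⊛_

data Expr (V : Set) : Set where
  var  : V → Expr V
  con  : ℤ → Expr V
  _⊕_  : Expr V → Expr V → Expr V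
  _⊛_  : Expr V → Expr V → Expr V
  ⊝_   : Expr V → Expr V

_⊖_ : ∀ {V} → Expr V → Expr V → Expr V
x ⊖ y = x ⊕ (⊝ y)

prod : ∀ {V} → List (Expr V) → Expr V
prod = foldr _⊛_ (con (ℤ.+ 1))

record Presentation : Set₁ where
  field
    Gen : Set
    Rel : Expr Gen → Set
open Presentation public

infix 4 _⊢_≈_
data _⊢_≈_ (P : Presentation) : Expr (Gen P) → Expr (Gen P) → Set where
  ≈-refl   : ∀ {x} → P ⊢ x ≈ x
  ≈-sym    : ∀ {x y} → P ⊢ x ≈ y → P ⊢ y ≈ x
  ≈-trans  : ∀ {x y z} → P ⊢ x ≈ y → P ⊢ y ≈ z → P ⊢ x ≈ z
  ⊕-cong   : ∀ {x x′ y y′} → P ⊢ x ≈ x′ → P ⊢ y ≈ y′ → P ⊢ x ⊕ y ≈ x′ ⊕ y′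
  ⊛-cong   : ∀ {x x′ y y′} → P ⊢ x ≈ x′ → P ⊢ y ≈ y′ → P ⊢ x ⊛ y ≈ x′ ⊛ y′
  ⊝-cong   : ∀ {x x′} → P ⊢ x ≈ x′ → P ⊢ ⊝ x ≈ ⊝ x′
  ⊕-assoc  : ∀ x y z → P ⊢ (x ⊕ y) ⊕ z ≈ x ⊕ (y ⊕ z)
  ⊕-comm   : ∀ x y → P ⊢ x ⊕ y ≈ y ⊕ x
  ⊕-idˡ    : ∀ x → P ⊢ con (ℤ.+ 0) ⊕ x ≈ x
  ⊝-invˡ   : ∀ x → P ⊢ (⊝ x) ⊕ x ≈ con (ℤ.+ 0)
  ⊛-assoc  : ∀ x y z → P ⊢ (x ⊛ y) ⊛ z ≈ x ⊛ (y ⊛ z)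
  ⊛-comm   : ∀ x y → P ⊢ x ⊛ y ≈ y ⊛ x
  ⊛-idˡ    : ∀ x → P ⊢ con (ℤ.+ 1) ⊛ x ≈ x
  distribʳ : ∀ x y z → P ⊢ (y ⊕ z) ⊛ x ≈ (y ⊛ x) ⊕ (z ⊛ x)
  con-+    : ∀ a b → P ⊢ con (a ℤ.+ b) ≈ con a ⊕ con b
  con-*    : ∀ a b → P ⊢ con (a ℤ.* b) ≈ con a ⊛ con b
  relation : ∀ {r} → Rel P r → P ⊢ r ≈ con (ℤ.+ 0)

_>>=_ : ∀ {V W} → Expr V → (V → Expr W) → Expr W
var v   >>= σ = σ v
con a   >>= σ = con a
(x ⊕ y) >>= σ = (x >>= σ) ⊕ (y >>= σ)
(x ⊛ y) >>= σ = (x >>= σ) ⊛ (y >>= σ)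
(⊝ x)   >>= σ = ⊝ (x >>= σ)

rename : ∀ {V W} → (V → W) → Expr V → Expr W
rename f e = e >>= (var ∘ f)

-- A (candidate) ring map between presented rings, given on generators.
record Hom (P Q : Presentation) : Set where
  constructor hom
  field
    apply : Gen P → Expr (Gen Q)
open Hom public

infixr 9 _∘ʰ_
_∘ʰ_ : ∀ {P Q R} → Hom Q R → Hom P Q → Hom P R
g ∘ʰ f = hom λ v → apply f v >>= apply g

idʰ : ∀ {P} → Hom P P
idʰ = hom var

infix 4 _≗ʰ_
_≗ʰ_ : ∀ {P Q} → Hom P Q → Hom P Q → Set
_≗ʰ_ {P} {Q} f g = ∀ (e : Expr (Gen P)) → Q ⊢ (e >>= apply f) ≈ (e >>= apply g)

-- Tensor product over ℤ:  ℤ[V]/I ⊗ ℤ[W]/J = ℤ[V ⊎ W]/(I + J).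
infixr 6 _⊗ᴾ_
_⊗ᴾ_ : Presentation → Presentation → Presentation
P ⊗ᴾ Q = record
  { Gen = Gen P ⊎ Gen Q
  ; Rel = λ r → (Σ (Expr (Gen P)) λ s → Rel P s × r ≡ rename inj₁ s)
              ⊎ (Σ (Expr (Gen Q)) λ s → Rel Q s × r ≡ rename inj₂ s) }

infixr 7 _⊗ʰ_
_⊗ʰ_ : ∀ {P P′ Q Q′} → Hom P P′ → Hom Q Q′ → Hom (P ⊗ᴾ Q) (P′ ⊗ᴾ Q′)
f ⊗ʰ g = hom [ rename inj₁ ∘ apply f , rename inj₂ ∘ apply g ]

assocʰ : ∀ {A B C} → Hom ((A ⊗ᴾ B) ⊗ᴾ C) (A ⊗ᴾ (B ⊗ᴾ C))
assocʰ = hom λ where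
  (inj₁ (inj₁ a)) → var (inj₁ a)
  (inj₁ (inj₂ b)) → var (inj₂ (inj₁ b))
  (inj₂ c)        → var (inj₂ (inj₂ c))

σ₂₃ : ∀ {A B C} → Hom (A ⊗ᴾ (B ⊗ᴾ C)) (A ⊗ᴾ (C ⊗ᴾ B))
σ₂₃ = hom λ where
  (inj₁ a)        → var (inj₁ a)
  (inj₂ (inj₁ b)) → var (inj₂ (inj₂ b))
  (inj₂ (inj₂ c)) → var (inj₂ (inj₁ c))

record FinLattice : Set₁ where
  field
    size    : ℕ
    _≤_     : BinRel (Fin size) 0ℓ
    _≤?_    : Decidable _≤_
    _∨_ _∧_ : Fin size → Fin size → Fin size
    ⊤̂ ⊥̂     : Fin size
    isBoundedLattice : IsBoundedLattice _≡_ _≤_ _∨_ _∧_ ⊤̂ ⊥̂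

  Carrier : Set
  Carrier = Fin size

  infix 4 _<_ _⋖_
  _<_ : BinRel Carrier 0ℓ
  x < y = x ≤ y × x ≢ y

  _⋖_ : BinRel Carrier 0ℓ
  x ⋖ y = x < y × (∀ z → x < z → ¬ (z < y))

  Incomparable : BinRel Carrier 0ℓ
  Incomparable x y = ¬ (x ≤ y) × ¬ (y ≤ x)

  IsAntichain : List Carrier → Set
  IsAntichain = AllPairs Incomparable

  ⋁[_]_ : Carrier → List Carrier → Carrier
  ⋁[ b ] xs = foldr _∨_ b xs

  data MaxChain : Carrier → Carrier → ℕ → Set where
    done : ∀ {x} → MaxChain x x zero
    step : ∀ {x y z k} → x ⋖ y → MaxChain y z k → MaxChain x z (suc k)

  IsAtom : Carrier → Set
  IsAtom x = ⊥̂ ⋖ x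


record IsGeometric (L : FinLattice) : Set where
  open FinLattice L
  field
    graded     : ∀ {x y k l} → MaxChain x y k → MaxChain x y l → k ≡ l
    -- the rank function  rk x = length of a maximal chain ⊥̂ … x  is
    -- submodular
    submodular : ∀ {x y a b c d} →
                 MaxChain ⊥̂ (x ∨ y) a → MaxChain ⊥̂ (x ∧ y) b →
                 MaxChain ⊥̂ x c → MaxChain ⊥̂ y d → a + b ℕ.≤ c + d
    atomistic  : ∀ x → Σ (List Carrier) λ as → All IsAtom as × ⋁[ ⊥̂ ] as ≡ x

module _ (L : FinLattice) where
  open FinLattice L

  -- elements of the product poset  ∏_{F ∈ fs} [⊥̂, F]
  Box : List Carrier → Set
  Box = All (λ F → Σ Carrier λ y → y ≤ F)

  joinBox : ∀ {fs} → Box fs → Carrier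
  joinBox []            = ⊥̂
  joinBox ((y , _) ∷ t) = y ∨ joinBox t

  _≤Box_ : ∀ {fs} → Box fs → Box fs → Set
  [] ≤Box [] = ⊤
  ((y , _) ∷ t) ≤Box ((y′ , _) ∷ t′) = y ≤ y′ × t ≤Box t′

  IsFactor : Subset size → Carrier → Carrier → Set
  IsFactor 𝒢 X F = F ∈ 𝒢 × F ≤ X × (∀ F′ → F′ ∈ 𝒢 → F′ ≤ X → F ≤ F′ → F′ ≡ F)

  -- the join map  ∏_{F ∈ fs} [⊥̂,F] → [⊥̂,X]  is a poset isomorphism
  JoinMapIso : Carrier → List Carrier → Set
  JoinMapIso X fs =
    (∀ y → y ≤ X → Σ (Box fs) λ t → joinBox t ≡ y) ×
    (∀ (t t′ : Box fs) → (joinBox t ≤ joinBox t′) ⇔ (t ≤Box t′))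

  record IsBuildingSet (𝒢 : Subset size) : Set where
    field
      ⊥∉𝒢      : ⊥̂ ∉ 𝒢
      factorize : ∀ X (fs : List Carrier) → Unique fs →
                  (∀ F → (F LMem.∈ fs) ⇔ IsFactor 𝒢 X F) →
                  JoinMapIso X fs

  IsIrreducible : Subset size → Set
  IsIrreducible 𝒢 = ⊤̂ ∈ 𝒢

  IsNested : Subset size → List Carrier → Set
  IsNested 𝒢 S = All (_∈ 𝒢) S ×
    (∀ A → A ⊆ S → IsAntichain A → 2 ℕ.≤ length A → ⋁[ ⊥̂ ] A ∉ 𝒢)

module Built (L : FinLattice) (𝒢 : Subset (FinLattice.size L)) where
  open FinLattice L

  Ind : Carrier → Carrier → Carrier → Set
  Ind a b X = a ≤ X × X ≤ b × X ≢ a × ∃ λ F → F ∈ 𝒢 × a ∨ F ≡ X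

  Ind? : ∀ a b X → Dec (Ind a b X)
  Ind? a b X = (a ≤? X) ×-dec (X ≤? b) ×-dec ¬? (X ≟ a)
               ×-dec any? (λ F → (F ∈? 𝒢) ×-dec ((a ∨ F) ≟ X))

  record IVar (a b : Carrier) : Set where
    constructor ⟨_,_⟩
    field
      elt  : Carrier
      .mem : Ind a b elt
  open IVar public

  -- the ideal of FY([a,b], Ind(𝒢)); atoms of [a,b] are elements covering a,
  -- the join of the empty family in [a,b] is a
  data FYRel (a b : Carrier) : Expr (IVar a b) → Set where
    atomRel      : (H : IVar a b) → a ⋖ elt H → FYRel a b (var H)
    antichainRel : (G : IVar a b) (A : List (IVar a b)) →
                   IsAntichain (map elt A) → ⋁[ a ] (map elt A) ≡ elt G →
                   FYRel a b (prod (map (λ G′ → var G ⊖ var G′) A))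

  FY : Carrier → Carrier → Presentation
  FY a b = record { Gen = IVar a b ; Rel = FYRel a b }

  -- h_X as an element of FY([a,b]); the fallback 0 is only used when
  -- X ∉ Ind_{[a,b]}(𝒢), which never happens in the maps below.
  h : ∀ a b → Carrier → Expr (IVar a b)
  h a b X with Ind? a b X
  ... | yes p = var ⟨ X , p ⟩
  ... | no _  = con (ℤ.+ 0)

  fyG : ∀ a b (G : Carrier) → IVar a b → Expr (IVar G b ⊎ IVar a G)
  fyG a b G ⟨ X , _ ⟩ with X ≤? G
  ... | yes _ = rename inj₂ (h a G X)
  ... | no _  = rename inj₁ (h G b (G ∨ X))

  FY[_] : ∀ {a b} (G : Carrier) → Hom (FY a b) (FY G b ⊗ᴾ FY a G)
  FY[_] {a} {b} G = hom (fyG a b G)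

  joinMap : ∀ {a b} c d (K : Carrier) → Hom (FY a b) (FY c d)
  joinMap c d K = hom λ X → h c d (IVar.elt X ∨ K)

φ : (L L′ : FinLattice) (𝒢 : Subset (FinLattice.size L)) (𝒢′ : Subset (FinLattice.size L′)) →
    (f : FinLattice.Carrier L → FinLattice.Carrier L′) →
    ∀ {a b} a′ b′ → Hom (Built.FY L 𝒢 a b) (Built.FY L′ 𝒢′ a′ b′)
φ L L′ 𝒢 𝒢′ f a′ b′ = hom λ X → Built.h L′ 𝒢′ a′ b′ (f (Built.IVar.elt X))

module Submission where

-- All maps involved are ring maps given on the generators h_X, so every identity
-- is checked on a single h_X, by cases on where X lies relative to the G's; then
-- both sides are the same h_Y placed in the same tensor factor, or both are 0.
-- The one case needing the building-set axiom is (2) with X ≤ G₁ ∨ G₂ but X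
-- below neither G₁ nor G₂: as G₁ ∨ G₂ ∉ 𝒢 by nestedness, G₁ and G₂ lie in
-- distinct factors of G₁ ∨ G₂, and the product decomposition of [⊥̂, G₁ ∨ G₂]
-- puts X ∈ 𝒢 below one of them.

open import Defs
open import Level using (0ℓ)
open import Data.Empty using (⊥-elim; ⊥-elim-irr)
open import Data.Nat using (s≤s; z≤n)
open import Data.Integer using (+_)
open import Data.Fin.Induction using (po-noetherian)
open import Data.Fin.Properties using (any?; all?; _≟_)
open import Data.Fin.Subset using (Subset; _∈_; _∉_)
open import Data.Fin.Subset.Properties using (_∈?_)
open import Data.List using (List; []; _∷_; filter; allFin)
open import Data.List.Membership.Propositional using () renaming (_∈_ to _∈ˡ_)
open import Data.List.Membership.Propositional.Properties using (∈-filter⁺; ∈-filter⁻; ∈-allFin)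
open import Data.List.Relation.Unary.All using ([]; _∷_; universal)
open import Data.List.Relation.Unary.AllPairs using ([]; _∷_)
open import Data.List.Relation.Unary.Any using (here; there)
open import Data.List.Relation.Unary.Unique.Propositional using (Unique)
open import Data.List.Relation.Unary.Unique.Propositional.Properties using (filter⁺; allFin⁺)
open import Data.Product using (Σ; ∃; _×_; _,_; proj₁; proj₂)
open import Data.Sum using (_⊎_; inj₁; inj₂; [_,_])
open import Function using (id; flip)
open import Function.Bundles using (_⇔_; mk⇔; Equivalence)
open import Function.Definitions using (Bijective)
open import Induction.WellFounded using (Acc; acc)
open import Relation.Binary.Lattice.Bundles using (BoundedLattice)
import Relation.Binary.Lattice.Properties.JoinSemilattice as JoinSemilatticeProperties
import Relation.Binary.Lattice.Properties.BoundedJoinSemilattice as BoundedJoinSemilatticeProperties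
open import Relation.Binary.PropositionalEquality
  using (_≡_; _≢_; refl; sym; trans; cong; subst)
open import Relation.Nullary using (¬_; Dec; yes; no)
open import Relation.Nullary.Decidable using (_×-dec_; ¬?; _→-dec_)

>>=-cong : ∀ {P : Presentation} {V} (e : Expr V) {σ τ : V → Expr (Gen P)} →
           (∀ v → P ⊢ σ v ≈ τ v) → P ⊢ (e >>= σ) ≈ (e >>= τ)
>>=-cong (var v) σ≈τ = σ≈τ v
>>=-cong (con a) σ≈τ = ≈-refl
>>=-cong (e ⊕ e′) σ≈τ = ⊕-cong (>>=-cong e σ≈τ) (>>=-cong e′ σ≈τ)
>>=-cong (e ⊛ e′) σ≈τ = ⊛-cong (>>=-cong e σ≈τ) (>>=-cong e′ σ≈τ)
>>=-cong (⊝ e) σ≈τ = ⊝-cong (>>=-cong e σ≈τ)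

≗ʰ-onGenerators : ∀ {P Q} {f g : Hom P Q} → (∀ v → apply f v ≡ apply g v) → f ≗ʰ g
≗ʰ-onGenerators {Q = Q} f≡g e = >>=-cong e (λ v → subst (Q ⊢ _ ≈_) (f≡g v) ≈-refl)

module LatticeProperties (L : FinLattice) where
  open FinLattice L public

  boundedLattice : BoundedLattice 0ℓ 0ℓ 0ℓ
  boundedLattice = record { isBoundedLattice = isBoundedLattice }

  open BoundedLattice boundedLattice public
    using (x≤x∨y; y≤x∨y; ∨-least; maximum; minimum; isPartialOrder)
    renaming (refl to ≤-refl; trans to ≤-trans; antisym to ≤-antisym)
  open JoinSemilatticeProperties (BoundedLattice.joinSemilattice boundedLattice) public
    using (∨-comm; ∨-assoc; x≤y⇒x∨y≈y)
  open BoundedJoinSemilatticeProperties (BoundedLattice.boundedJoinSemilattice boundedLattice) public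
    using (identityˡ; identityʳ)

  y≤x⇒x∨[y∨z]≡x∨z : ∀ {x y} z → y ≤ x → x ∨ (y ∨ z) ≡ x ∨ z
  y≤x⇒x∨[y∨z]≡x∨z {x} {y} z y≤x =
    trans (sym (∨-assoc x y z)) (cong (_∨ z) (trans (∨-comm x y) (x≤y⇒x∨y≈y y≤x)))

  y≰z⇒x∨y≰z : ∀ {x y z} → ¬ y ≤ z → ¬ (x ∨ y) ≤ z
  y≰z⇒x∨y≰z {x} {y} y≰z x∨y≤z = y≰z (≤-trans (y≤x∨y x y) x∨y≤z)

  <-noetherian : ∀ x → Acc (flip _<_) x
  <-noetherian = po-noetherian isPartialOrder

module BuildingSetProperties (L : FinLattice) (𝒢 : Subset (FinLattice.size L)) where
  open LatticeProperties L

  IsFactor? : ∀ X F → Dec (IsFactor L 𝒢 X F)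
  IsFactor? X F = (F ∈? 𝒢) ×-dec (F ≤? X) ×-dec
    all? (λ F′ → (F′ ∈? 𝒢) →-dec ((F′ ≤? X) →-dec ((F ≤? F′) →-dec (F′ ≟ F))))

  factors : Carrier → List Carrier
  factors X = filter (IsFactor? X) (allFin size)

  factors-unique : ∀ X → Unique (factors X)
  factors-unique X = filter⁺ (IsFactor? X) (allFin⁺ size)

  ∈-factors⇔ : ∀ X F → (F ∈ˡ factors X) ⇔ IsFactor L 𝒢 X F
  ∈-factors⇔ X F = mk⇔ (λ i → proj₂ (∈-filter⁻ (IsFactor? X) {xs = allFin size} i))
                       (∈-filter⁺ (IsFactor? X) (∈-allFin F))

  factor-above : ∀ X {G} → G ∈ 𝒢 → G ≤ X → ∃ λ F → IsFactor L 𝒢 X F × G ≤ F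
  factor-above X {G} = go G (<-noetherian G)
    where
    go : ∀ G → Acc (flip _<_) G → G ∈ 𝒢 → G ≤ X → ∃ λ F → IsFactor L 𝒢 X F × G ≤ F
    go G (acc rec) G∈𝒢 G≤X
      with any? (λ G′ → (G′ ∈? 𝒢) ×-dec ((G ≤? G′) ×-dec ¬? (G ≟ G′)) ×-dec (G′ ≤? X))
    ... | yes (G′ , G′∈𝒢 , G<G′ , G′≤X) =
      let F , F-factor , G′≤F = go G′ (rec G<G′) G′∈𝒢 G′≤X
      in F , F-factor , ≤-trans (proj₁ G<G′) G′≤F
    ... | no nothingAbove = G , (G∈𝒢 , G≤X , maximal) , ≤-refl
      where
      maximal : ∀ G′ → G′ ∈ 𝒢 → G′ ≤ X → G ≤ G′ → G′ ≡ G
      maximal G′ G′∈𝒢 G′≤X G≤G′ with G′ ≟ G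
      ... | yes G′≡G = G′≡G
      ... | no G′≢G = ⊥-elim (nothingAbove (G′ , G′∈𝒢 , (G≤G′ , λ G≡G′ → G′≢G (sym G≡G′)) , G′≤X))

  Component : Carrier → Set
  Component F = Σ Carrier (_≤ F)

  bottomComponent : ∀ F → Component F
  bottomComponent F = ⊥̂ , minimum F

  _[_≔_] : (∀ F → Component F) → ∀ M → Component M → ∀ F → Component F
  (k [ M ≔ y ]) F with F ≟ M
  ... | yes refl = y
  ... | no _ = k F

  ≔-same : ∀ k M y → (k [ M ≔ y ]) M ≡ y
  ≔-same k M y with M ≟ M
  ... | yes refl = refl
  ... | no M≢M = ⊥-elim (M≢M refl)

  ≔-other : ∀ k {M} y {F} → F ≢ M → (k [ M ≔ y ]) F ≡ k F
  ≔-other k {M} y {F} F≢M with F ≟ M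
  ... | yes F≡M = ⊥-elim (F≢M F≡M)
  ... | no _ = refl

  ≤-joinBox : ∀ (k : ∀ F → Component F) {F} fs → F ∈ˡ fs → proj₁ (k F) ≤ joinBox L (universal k fs)
  ≤-joinBox k (F ∷ fs) (here refl) = x≤x∨y _ _
  ≤-joinBox k (F′ ∷ fs) (there F∈fs) = ≤-trans (≤-joinBox k fs F∈fs) (y≤x∨y _ _)

  joinBox-least : ∀ (k : ∀ F → Component F) {c} fs → (∀ F → proj₁ (k F) ≤ c) →
                  joinBox L (universal k fs) ≤ c
  joinBox-least k [] k≤c = minimum _
  joinBox-least k (F ∷ fs) k≤c = ∨-least (k≤c F) (joinBox-least k fs k≤c)

  ≤Box-component : ∀ (k k′ : ∀ F → Component F) {F} fs → F ∈ˡ fs →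
                   _≤Box_ L (universal k fs) (universal k′ fs) → proj₁ (k F) ≤ proj₁ (k′ F)
  ≤Box-component k k′ (F ∷ fs) (here refl) (k≤k′ , _) = k≤k′
  ≤Box-component k k′ (F′ ∷ fs) (there F∈fs) (_ , k≤k′) = ≤Box-component k k′ fs F∈fs k≤k′

  -- X lies in a single factor M of G₁ ∨ G₂.  Putting X at M, resp. G₁ and G₂ at
  -- their (necessarily distinct) factors, the join map reflects X ≤ G₁ ∨ G₂ to
  -- the M-components, so X ≤ G₁ or X ≤ G₂.
  module FactorsOfJoin (B : IsBuildingSet L 𝒢) {G₁ G₂ X M M₁ M₂ : Carrier}
    (G₁∨G₂∉𝒢 : (G₁ ∨ G₂) ∉ 𝒢) (X≤G₁∨G₂ : X ≤ (G₁ ∨ G₂))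
    (M-factor : IsFactor L 𝒢 (G₁ ∨ G₂) M) (X≤M : X ≤ M)
    (M₁-factor : IsFactor L 𝒢 (G₁ ∨ G₂) M₁) (G₁≤M₁ : G₁ ≤ M₁)
    (M₂-factor : IsFactor L 𝒢 (G₁ ∨ G₂) M₂) (G₂≤M₂ : G₂ ≤ M₂) where

    fs : List Carrier
    fs = factors (G₁ ∨ G₂)

    factor∈fs : ∀ {F} → IsFactor L 𝒢 (G₁ ∨ G₂) F → F ∈ˡ fs
    factor∈fs {F} = Equivalence.from (∈-factors⇔ (G₁ ∨ G₂) F)

    joinBox-reflects : ∀ (t t′ : Box L fs) → joinBox L t ≤ joinBox L t′ → _≤Box_ L t t′
    joinBox-reflects t t′ = Equivalence.to
      (proj₂ (IsBuildingSet.factorize B (G₁ ∨ G₂) fs (factors-unique _) (∈-factors⇔ _)) t t′)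

    M₂≢M₁ : M₂ ≢ M₁
    M₂≢M₁ M₂≡M₁ = G₁∨G₂∉𝒢 (subst (_∈ 𝒢) M₁≡G₁∨G₂ (proj₁ M₁-factor))
      where
      M₁≡G₁∨G₂ : M₁ ≡ G₁ ∨ G₂
      M₁≡G₁∨G₂ = ≤-antisym (proj₁ (proj₂ M₁-factor)) (∨-least G₁≤M₁ (subst (G₂ ≤_) M₂≡M₁ G₂≤M₂))

    kX kG : ∀ F → Component F
    kX = bottomComponent [ M ≔ (X , X≤M) ]
    kG = (bottomComponent [ M₂ ≔ (G₂ , G₂≤M₂) ]) [ M₁ ≔ (G₁ , G₁≤M₁) ]

    kX≤X : ∀ F → proj₁ (kX F) ≤ X
    kX≤X F with F ≟ M
    ... | yes refl = ≤-refl
    ... | no _ = minimum X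

    kG≤G₁⊎kG≤G₂ : ∀ F → proj₁ (kG F) ≤ G₁ ⊎ proj₁ (kG F) ≤ G₂
    kG≤G₁⊎kG≤G₂ F with F ≟ M₁
    ... | yes refl = inj₁ ≤-refl
    ... | no _ with F ≟ M₂
    ...   | yes refl = inj₂ ≤-refl
    ...   | no _ = inj₁ (minimum G₁)

    G₁≤kG : G₁ ≤ proj₁ (kG M₁)
    G₁≤kG rewrite ≔-same (bottomComponent [ M₂ ≔ (G₂ , G₂≤M₂) ]) M₁ (G₁ , G₁≤M₁) = ≤-refl

    G₂≤kG : G₂ ≤ proj₁ (kG M₂)
    G₂≤kG rewrite ≔-other (bottomComponent [ M₂ ≔ (G₂ , G₂≤M₂) ]) (G₁ , G₁≤M₁) M₂≢M₁
                | ≔-same bottomComponent M₂ (G₂ , G₂≤M₂) = ≤-refl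

    X≤kX : X ≤ proj₁ (kX M)
    X≤kX rewrite ≔-same bottomComponent M (X , X≤M) = ≤-refl

    joinX≤joinG : joinBox L (universal kX fs) ≤ joinBox L (universal kG fs)
    joinX≤joinG = ≤-trans (joinBox-least kX fs kX≤X) (≤-trans X≤G₁∨G₂
      (∨-least (≤-trans G₁≤kG (≤-joinBox kG fs (factor∈fs M₁-factor)))
               (≤-trans G₂≤kG (≤-joinBox kG fs (factor∈fs M₂-factor)))))

    X≤kG : X ≤ proj₁ (kG M)
    X≤kG = ≤-trans X≤kX (≤Box-component kX kG fs (factor∈fs M-factor)
                          (joinBox-reflects (universal kX fs) (universal kG fs) joinX≤joinG))

    X≤G₁⊎X≤G₂ : X ≤ G₁ ⊎ X ≤ G₂
    X≤G₁⊎X≤G₂ = [ (λ kG≤G₁ → inj₁ (≤-trans X≤kG kG≤G₁)) , (λ kG≤G₂ → inj₂ (≤-trans X≤kG kG≤G₂)) ]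
                  (kG≤G₁⊎kG≤G₂ M)

  below-∨∉𝒢⇒below-either : IsBuildingSet L 𝒢 → ∀ {G₁ G₂ X} → G₁ ∈ 𝒢 → G₂ ∈ 𝒢 → (G₁ ∨ G₂) ∉ 𝒢 →
                           X ∈ 𝒢 → X ≤ (G₁ ∨ G₂) → X ≤ G₁ ⊎ X ≤ G₂
  below-∨∉𝒢⇒below-either B {G₁} {G₂} G₁∈𝒢 G₂∈𝒢 G₁∨G₂∉𝒢 X∈𝒢 X≤G₁∨G₂ =
    let _ , M-factor  , X≤M   = factor-above _ X∈𝒢 X≤G₁∨G₂
        _ , M₁-factor , G₁≤M₁ = factor-above _ G₁∈𝒢 (x≤x∨y G₁ G₂)
        _ , M₂-factor , G₂≤M₂ = factor-above _ G₂∈𝒢 (y≤x∨y G₁ G₂)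
    in FactorsOfJoin.X≤G₁⊎X≤G₂ B G₁∨G₂∉𝒢 X≤G₁∨G₂ M-factor X≤M M₁-factor G₁≤M₁ M₂-factor G₂≤M₂

  nested-pair⇒∨∉ : ∀ {G₁ G₂} → Incomparable G₁ G₂ → IsNested L 𝒢 (G₁ ∷ G₂ ∷ []) → (G₁ ∨ G₂) ∉ 𝒢
  nested-pair⇒∨∉ {G₁} {G₂} G₁∥G₂ (_ , antichainJoin∉𝒢) =
    subst (_∉ 𝒢) (cong (G₁ ∨_) (identityʳ G₂))
      (antichainJoin∉𝒢 (G₁ ∷ G₂ ∷ []) id ((G₁∥G₂ ∷ []) ∷ [] ∷ []) (s≤s (s≤s z≤n)))

module FYProperties (L : FinLattice) (𝒢 : Subset (FinLattice.size L)) where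
  open LatticeProperties L
  open Built L 𝒢

  h-Ind : ∀ {a b X} .(X∈Ind : Ind a b X) → h a b X ≡ var ⟨ X , X∈Ind ⟩
  h-Ind {a} {b} {X} X∈Ind with Ind? a b X
  ... | yes _ = refl
  ... | no X∉Ind = ⊥-elim-irr (X∉Ind X∈Ind)

  h-¬Ind : ∀ {a b X} → ¬ Ind a b X → h a b X ≡ con (+ 0)
  h-¬Ind {a} {b} {X} X∉Ind with Ind? a b X
  ... | yes X∈Ind = ⊥-elim (X∉Ind X∈Ind)
  ... | no _ = refl

  Ind-restrict : ∀ {a b c X} → Ind a b X → X ≤ c → Ind a c X
  Ind-restrict (a≤X , _ , X≢a , F) X≤c = a≤X , X≤c , X≢a , F

  Ind-join : ∀ {a b c d X} → Ind a b X → a ≤ c → ¬ X ≤ c → (c ∨ X) ≤ d → Ind c d (c ∨ X)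
  Ind-join {c = c} {X = X} (_ , _ , _ , F , F∈𝒢 , a∨F≡X) a≤c X≰c c∨X≤d =
    x≤x∨y c X , c∨X≤d ,
    (λ c∨X≡c → X≰c (subst (X ≤_) c∨X≡c (y≤x∨y c X))) ,
    F , F∈𝒢 , trans (sym (y≤x⇒x∨[y∨z]≡x∨z F a≤c)) (cong (c ∨_) a∨F≡X)

  Ind-join-within : ∀ {a b c X} → Ind a b X → a ≤ c → c ≤ b → ¬ X ≤ c → Ind c b (c ∨ X)
  Ind-join-within X∈Ind a≤c c≤b X≰c = Ind-join X∈Ind a≤c X≰c (∨-least c≤b (proj₁ (proj₂ X∈Ind)))

  Ind-⊥̂⇒∈𝒢 : ∀ {b X} → Ind ⊥̂ b X → X ∈ 𝒢
  Ind-⊥̂⇒∈𝒢 (_ , _ , _ , F , F∈𝒢 , ⊥̂∨F≡X) = subst (_∈ 𝒢) (trans (sym (identityˡ F)) ⊥̂∨F≡X) F∈𝒢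

  fyG-below : ∀ {a b G X} .{X∈Ind : Ind a b X} (X≤G : X ≤ G) →
              fyG a b G ⟨ X , X∈Ind ⟩ ≡ var (inj₂ ⟨ X , Ind-restrict X∈Ind X≤G ⟩)
  fyG-below {a} {b} {G} {X} {X∈Ind} X≤G with X ≤? G
  ... | yes _ = cong (rename inj₂) (h-Ind (Ind-restrict X∈Ind X≤G))
  ... | no X≰G = ⊥-elim (X≰G X≤G)

  fyG-above : ∀ {a b G X} .{X∈Ind : Ind a b X} → ¬ X ≤ G →
              fyG a b G ⟨ X , X∈Ind ⟩ ≡ rename inj₁ (h G b (G ∨ X))
  fyG-above {a} {b} {G} {X} X≰G with X ≤? G
  ... | yes X≤G = ⊥-elim (X≰G X≤G)
  ... | no _ = refl

  module Coassociativity {a b G₁ G₂} (a≤G₁ : a ≤ G₁) (G₁≤G₂ : G₁ ≤ G₂) (G₂≤b : G₂ ≤ b) where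

    FY[G₁]-then-FY[G₂] FY[G₂]-then-FY[G₁] : Hom (FY a b) (FY G₂ b ⊗ᴾ (FY G₁ G₂ ⊗ᴾ FY a G₁))
    FY[G₁]-then-FY[G₂] = assocʰ ∘ʰ (FY[_] {G₁} {b} G₂ ⊗ʰ idʰ) ∘ʰ FY[_] {a} {b} G₁
    FY[G₂]-then-FY[G₁] = (idʰ ⊗ʰ FY[_] {a} {G₂} G₁) ∘ʰ FY[_] {a} {b} G₂

    G₁≤b : G₁ ≤ b
    G₁≤b = ≤-trans G₁≤G₂ G₂≤b

    ≰G₂⇒≰G₁ : ∀ {X} → ¬ X ≤ G₂ → ¬ X ≤ G₁
    ≰G₂⇒≰G₁ X≰G₂ X≤G₁ = X≰G₂ (≤-trans X≤G₁ G₁≤G₂)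

    agree : ∀ X .(X∈Ind : Ind a b X) → Dec (X ≤ G₁) → Dec (X ≤ G₂) →
            apply FY[G₁]-then-FY[G₂] ⟨ X , X∈Ind ⟩ ≡ apply FY[G₂]-then-FY[G₁] ⟨ X , X∈Ind ⟩
    agree X X∈Ind (yes X≤G₁) _
      rewrite fyG-below {X∈Ind = X∈Ind} X≤G₁
            | fyG-below {G = G₂} {X∈Ind = X∈Ind} (≤-trans X≤G₁ G₁≤G₂)
            | fyG-below {G = G₁} {X∈Ind = Ind-restrict X∈Ind (≤-trans X≤G₁ G₁≤G₂)} X≤G₁
      = refl
    agree X X∈Ind (no X≰G₁) (yes X≤G₂)
      rewrite fyG-above {X∈Ind = X∈Ind} X≰G₁
            | h-Ind (Ind-join-within X∈Ind a≤G₁ G₁≤b X≰G₁)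
            | fyG-below {G = G₂} {X∈Ind = Ind-join-within X∈Ind a≤G₁ G₁≤b X≰G₁} (∨-least G₁≤G₂ X≤G₂)
            | fyG-below {G = G₂} {X∈Ind = X∈Ind} X≤G₂
            | fyG-above {X∈Ind = Ind-restrict X∈Ind X≤G₂} X≰G₁
            | h-Ind (Ind-join (Ind-restrict X∈Ind X≤G₂) a≤G₁ X≰G₁ (∨-least G₁≤G₂ X≤G₂))
      = refl
    agree X X∈Ind _ (no X≰G₂)
      rewrite fyG-above {X∈Ind = X∈Ind} (≰G₂⇒≰G₁ X≰G₂)
            | h-Ind (Ind-join-within X∈Ind a≤G₁ G₁≤b (≰G₂⇒≰G₁ X≰G₂))
            | fyG-above {X∈Ind = Ind-join-within X∈Ind a≤G₁ G₁≤b (≰G₂⇒≰G₁ X≰G₂)} (y≰z⇒x∨y≰z X≰G₂)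
            | y≤x⇒x∨[y∨z]≡x∨z X G₁≤G₂
            | fyG-above {X∈Ind = X∈Ind} X≰G₂
            | h-Ind (Ind-join-within X∈Ind (≤-trans a≤G₁ G₁≤G₂) G₂≤b X≰G₂)
      = refl

    FY-coassoc : FY[G₁]-then-FY[G₂] ≗ʰ FY[G₂]-then-FY[G₁]
    FY-coassoc = ≗ʰ-onGenerators {f = FY[G₁]-then-FY[G₂]} λ
      { ⟨ X , X∈Ind ⟩ → agree X X∈Ind (X ≤? G₁) (X ≤? G₂) }

  module Commutation (B : IsBuildingSet L 𝒢) {b G₁ G₂} (G₁∈𝒢 : G₁ ∈ 𝒢) (G₂∈𝒢 : G₂ ∈ 𝒢)
                     (G₁∨G₂∉𝒢 : (G₁ ∨ G₂) ∉ 𝒢) (G₁∨G₂≤b : (G₁ ∨ G₂) ≤ b) where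
    open BuildingSetProperties L 𝒢 using (below-∨∉𝒢⇒below-either)

    J : Carrier
    J = G₁ ∨ G₂

    G₁≤J : G₁ ≤ J
    G₁≤J = x≤x∨y G₁ G₂

    G₂≤J : G₂ ≤ J
    G₂≤J = y≤x∨y G₁ G₂

    via-G₁ : Hom (FY ⊥̂ b) (FY J b ⊗ᴾ (FY G₁ J ⊗ᴾ FY G₂ J))
    via-G₁ = assocʰ ∘ʰ (idʰ ⊗ʰ joinMap {⊥̂} {G₁} G₂ J G₂)
               ∘ʰ (FY[_] {G₁} {b} J ⊗ʰ idʰ) ∘ʰ FY[_] {⊥̂} {b} G₁

    via-G₂ : Hom (FY ⊥̂ b) (FY J b ⊗ᴾ (FY G₁ J ⊗ᴾ FY G₂ J))
    via-G₂ = σ₂₃ ∘ʰ assocʰ ∘ʰ (idʰ ⊗ʰ joinMap {⊥̂} {G₂} G₁ J G₁)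
               ∘ʰ (FY[_] {G₂} {b} J ⊗ʰ idʰ) ∘ʰ FY[_] {⊥̂} {b} G₂

    agree : ∀ X .(X∈Ind : Ind ⊥̂ b X) → Dec (X ≤ G₁) → Dec (X ≤ G₂) →
            apply via-G₁ ⟨ X , X∈Ind ⟩ ≡ apply via-G₂ ⟨ X , X∈Ind ⟩
    agree X X∈Ind (yes X≤G₁) (yes X≤G₂)
      rewrite fyG-below {X∈Ind = X∈Ind} X≤G₁
            | h-¬Ind {G₂} {J} {X ∨ G₂} (λ { (_ , _ , X∨G₂≢G₂ , _) → X∨G₂≢G₂ (x≤y⇒x∨y≈y X≤G₂) })
            | fyG-below {X∈Ind = X∈Ind} X≤G₂
            | h-¬Ind {G₁} {J} {X ∨ G₁} (λ { (_ , _ , X∨G₁≢G₁ , _) → X∨G₁≢G₁ (x≤y⇒x∨y≈y X≤G₁) })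
      = refl
    agree X X∈Ind (yes X≤G₁) (no X≰G₂)
      rewrite fyG-below {X∈Ind = X∈Ind} X≤G₁
            | ∨-comm X G₂
            | h-Ind (Ind-join X∈Ind (minimum G₂) X≰G₂ (∨-least G₂≤J (≤-trans X≤G₁ G₁≤J)))
            | fyG-above {X∈Ind = X∈Ind} X≰G₂
            | h-Ind (Ind-join-within X∈Ind (minimum G₂) (≤-trans G₂≤J G₁∨G₂≤b) X≰G₂)
            | fyG-below {X∈Ind = Ind-join-within X∈Ind (minimum G₂) (≤-trans G₂≤J G₁∨G₂≤b) X≰G₂}
                        (∨-least G₂≤J (≤-trans X≤G₁ G₁≤J))
      = refl
    agree X X∈Ind (no X≰G₁) (yes X≤G₂)
      rewrite fyG-above {X∈Ind = X∈Ind} X≰G₁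
            | h-Ind (Ind-join-within X∈Ind (minimum G₁) (≤-trans G₁≤J G₁∨G₂≤b) X≰G₁)
            | fyG-below {X∈Ind = Ind-join-within X∈Ind (minimum G₁) (≤-trans G₁≤J G₁∨G₂≤b) X≰G₁}
                        (∨-least G₁≤J (≤-trans X≤G₂ G₂≤J))
            | fyG-below {X∈Ind = X∈Ind} X≤G₂
            | ∨-comm X G₁
            | h-Ind (Ind-join X∈Ind (minimum G₁) X≰G₁ (∨-least G₁≤J (≤-trans X≤G₂ G₂≤J)))
      = refl
    agree X X∈Ind (no X≰G₁) (no X≰G₂) with X ≤? J
    ... | yes X≤J = ⊥-elim-irr ([ X≰G₁ , X≰G₂ ]
      (below-∨∉𝒢⇒below-either B G₁∈𝒢 G₂∈𝒢 G₁∨G₂∉𝒢 (Ind-⊥̂⇒∈𝒢 X∈Ind) X≤J))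
    ... | no X≰J
      rewrite fyG-above {X∈Ind = X∈Ind} X≰G₁
            | h-Ind (Ind-join-within X∈Ind (minimum G₁) (≤-trans G₁≤J G₁∨G₂≤b) X≰G₁)
            | fyG-above {X∈Ind = Ind-join-within X∈Ind (minimum G₁) (≤-trans G₁≤J G₁∨G₂≤b) X≰G₁}
                        (y≰z⇒x∨y≰z X≰J)
            | y≤x⇒x∨[y∨z]≡x∨z X G₁≤J
            | fyG-above {X∈Ind = X∈Ind} X≰G₂
            | h-Ind (Ind-join-within X∈Ind (minimum G₂) (≤-trans G₂≤J G₁∨G₂≤b) X≰G₂)
            | fyG-above {X∈Ind = Ind-join-within X∈Ind (minimum G₂) (≤-trans G₂≤J G₁∨G₂≤b) X≰G₂}
                        (y≰z⇒x∨y≰z X≰J)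
            | y≤x⇒x∨[y∨z]≡x∨z X G₂≤J
            | h-Ind (Ind-join-within X∈Ind (minimum J) G₁∨G₂≤b X≰J)
      = refl

    FY-commute : via-G₁ ≗ʰ via-G₂
    FY-commute = ≗ʰ-onGenerators {f = via-G₁} λ { ⟨ X , X∈Ind ⟩ → agree X X∈Ind (X ≤? G₁) (X ≤? G₂) }

module OrderIsomorphism (L L′ : FinLattice) (f : FinLattice.Carrier L → FinLattice.Carrier L′)
                        (f-bijective : Bijective _≡_ _≡_ f)
                        (f-≤⇔ : ∀ x y → FinLattice._≤_ L x y ⇔ FinLattice._≤_ L′ (f x) (f y)) where
  module L = LatticeProperties L
  module L′ = LatticeProperties L′

  f-injective : ∀ {x y} → f x ≡ f y → x ≡ y
  f-injective = proj₁ f-bijective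

  f-surjective : ∀ y → ∃ λ x → f x ≡ y
  f-surjective y = proj₁ (proj₂ f-bijective y) , proj₂ (proj₂ f-bijective y) refl

  f-mono : ∀ {x y} → x L.≤ y → f x L′.≤ f y
  f-mono {x} {y} = Equivalence.to (f-≤⇔ x y)

  f-reflects : ∀ {x y} → f x L′.≤ f y → x L.≤ y
  f-reflects {x} {y} = Equivalence.from (f-≤⇔ x y)

  f-∨ : ∀ x y → f (x L.∨ y) ≡ f x L′.∨ f y
  f-∨ x y with f-surjective (f x L′.∨ f y)
  ... | z , fz≡fx∨fy = L′.≤-antisym
    (subst (f (x L.∨ y) L′.≤_) fz≡fx∨fy
      (f-mono (L.∨-least (f-reflects (subst (f x L′.≤_) (sym fz≡fx∨fy) (L′.x≤x∨y _ _)))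
                         (f-reflects (subst (f y L′.≤_) (sym fz≡fx∨fy) (L′.y≤x∨y _ _))))))
    (L′.∨-least (f-mono (L.x≤x∨y x y)) (f-mono (L.y≤x∨y x y)))

  f-⊥̂ : f L.⊥̂ ≡ L′.⊥̂
  f-⊥̂ with f-surjective L′.⊥̂
  ... | z , fz≡⊥̂ = L′.≤-antisym (subst (f L.⊥̂ L′.≤_) fz≡⊥̂ (f-mono (L.minimum z))) (L′.minimum _)

  f-⊤̂ : f L.⊤̂ ≡ L′.⊤̂
  f-⊤̂ with f-surjective L′.⊤̂
  ... | z , fz≡⊤̂ = L′.≤-antisym (L′.maximum _) (subst (L′._≤ f L.⊤̂) fz≡⊤̂ (f-mono (L.maximum z)))

  module Naturality (𝒢 : Subset L.size) (𝒢′ : Subset L′.size) (f-𝒢 : ∀ {x} → x ∈ 𝒢 → f x ∈ 𝒢′) where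
    open Built L 𝒢 using (Ind; FY; ⟨_,_⟩; FY[_])
    open FYProperties L 𝒢 using (h-Ind; Ind-join-within; fyG-below; fyG-above)
    module B′ = Built L′ 𝒢′
    module F′ = FYProperties L′ 𝒢′

    Ind-image : ∀ {a b X} → Ind a b X → B′.Ind (f a) (f b) (f X)
    Ind-image {a} (a≤X , X≤b , X≢a , F , F∈𝒢 , a∨F≡X) =
      f-mono a≤X , f-mono X≤b , (λ fX≡fa → X≢a (f-injective fX≡fa)) ,
      f F , f-𝒢 F∈𝒢 , trans (sym (f-∨ a F)) (cong f a∨F≡X)

    FY-natural : ∀ {a b G a′ b′} → f a ≡ a′ → f b ≡ b′ → a L.≤ G → G L.≤ b →
      B′.FY[_] {a′} {b′} (f G) ∘ʰ φ L L′ 𝒢 𝒢′ f {a} {b} a′ b′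
        ≗ʰ (φ L L′ 𝒢 𝒢′ f {G} {b} (f G) b′ ⊗ʰ φ L L′ 𝒢 𝒢′ f {a} {G} a′ (f G)) ∘ʰ FY[_] {a} {b} G
    FY-natural {a} {b} {G} refl refl a≤G G≤b = ≗ʰ-onGenerators {f = φ-then-FY[fG]} λ
      { ⟨ X , X∈Ind ⟩ → agree X X∈Ind (X L.≤? G) }
      where
      φ-then-FY[fG] FY[G]-then-φ : Hom (FY a b) (B′.FY (f G) (f b) ⊗ᴾ B′.FY (f a) (f G))
      φ-then-FY[fG] = B′.FY[_] {f a} {f b} (f G) ∘ʰ φ L L′ 𝒢 𝒢′ f {a} {b} (f a) (f b)
      FY[G]-then-φ = (φ L L′ 𝒢 𝒢′ f {G} {b} (f G) (f b) ⊗ʰ φ L L′ 𝒢 𝒢′ f {a} {G} (f a) (f G))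
                     ∘ʰ FY[_] {a} {b} G

      agree : ∀ X .(X∈Ind : Ind a b X) → Dec (X L.≤ G) →
              apply φ-then-FY[fG] ⟨ X , X∈Ind ⟩ ≡ apply FY[G]-then-φ ⟨ X , X∈Ind ⟩
      agree X X∈Ind (yes X≤G)
        rewrite F′.h-Ind (Ind-image X∈Ind)
              | F′.fyG-below {X∈Ind = Ind-image X∈Ind} (f-mono X≤G)
              | fyG-below {X∈Ind = X∈Ind} X≤G
              | F′.h-Ind (F′.Ind-restrict (Ind-image X∈Ind) (f-mono X≤G))
        = refl
      agree X X∈Ind (no X≰G)
        rewrite F′.h-Ind (Ind-image X∈Ind)
              | F′.fyG-above {X∈Ind = Ind-image X∈Ind} (λ fX≤fG → X≰G (f-reflects fX≤fG))
              | fyG-above {X∈Ind = X∈Ind} X≰G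
              | h-Ind (Ind-join-within X∈Ind a≤G G≤b X≰G)
              | f-∨ G X
        = refl

mainTheorem11 :
  (L : FinLattice) → IsGeometric L →
  (𝒢 : Subset (FinLattice.size L)) → IsBuildingSet L 𝒢 → IsIrreducible L 𝒢 →
  let open FinLattice L
      open Built L 𝒢
  in
  -- (1)
  (∀ G₁ G₂ → G₁ ∈ 𝒢 → G₂ ∈ 𝒢 → G₁ < G₂ → G₂ < ⊤̂ →
    assocʰ ∘ʰ (FY[_] {G₁} {⊤̂} G₂ ⊗ʰ idʰ) ∘ʰ FY[_] {⊥̂} {⊤̂} G₁
      ≗ʰ (idʰ ⊗ʰ FY[_] {⊥̂} {G₂} G₁) ∘ʰ FY[_] {⊥̂} {⊤̂} G₂)
  ×
  -- (2)
  (∀ G₁ G₂ → G₁ ∈ 𝒢 → G₂ ∈ 𝒢 → G₁ ≢ ⊤̂ → G₂ ≢ ⊤̂ → Incomparable G₁ G₂ →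
    IsNested L 𝒢 (G₁ ∷ G₂ ∷ []) →
    assocʰ ∘ʰ (idʰ ⊗ʰ joinMap {⊥̂} {G₁} G₂ (G₁ ∨ G₂) G₂)
           ∘ʰ (FY[_] {G₁} {⊤̂} (G₁ ∨ G₂) ⊗ʰ idʰ) ∘ʰ FY[_] {⊥̂} {⊤̂} G₁
      ≗ʰ σ₂₃ ∘ʰ assocʰ ∘ʰ (idʰ ⊗ʰ joinMap {⊥̂} {G₂} G₁ (G₁ ∨ G₂) G₁)
           ∘ʰ (FY[_] {G₂} {⊤̂} (G₁ ∨ G₂) ⊗ʰ idʰ) ∘ʰ FY[_] {⊥̂} {⊤̂} G₂)
  ×
  -- (3)
  (∀ (L′ : FinLattice) → IsGeometric L′ →
    (𝒢′ : Subset (FinLattice.size L′)) → IsBuildingSet L′ 𝒢′ → IsIrreducible L′ 𝒢′ →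
    (f : Carrier → FinLattice.Carrier L′) →
    Bijective _≡_ _≡_ f → (∀ x y → (x ≤ y) ⇔ FinLattice._≤_ L′ (f x) (f y)) →
    (∀ y → (y ∈ 𝒢′) ⇔ ∃ λ x → x ∈ 𝒢 × f x ≡ y) →
    ∀ G → G ∈ 𝒢 → G ≢ ⊤̂ →
    Built.FY[_] L′ 𝒢′ {FinLattice.⊥̂ L′} {FinLattice.⊤̂ L′} (f G)
        ∘ʰ φ L L′ 𝒢 𝒢′ f {⊥̂} {⊤̂} (FinLattice.⊥̂ L′) (FinLattice.⊤̂ L′)
      ≗ʰ (φ L L′ 𝒢 𝒢′ f {G} {⊤̂} (f G) (FinLattice.⊤̂ L′)
            ⊗ʰ φ L L′ 𝒢 𝒢′ f {⊥̂} {G} (FinLattice.⊥̂ L′) (f G))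
          ∘ʰ FY[_] {⊥̂} {⊤̂} G)
mainTheorem11 L _ 𝒢 B _ =
    (λ G₁ G₂ _ _ G₁<G₂ _ →
      Coassociativity.FY-coassoc (minimum G₁) (proj₁ G₁<G₂) (maximum G₂))
  , (λ G₁ G₂ G₁∈𝒢 G₂∈𝒢 _ _ G₁∥G₂ nested →
      Commutation.FY-commute B G₁∈𝒢 G₂∈𝒢 (nested-pair⇒∨∉ G₁∥G₂ nested) (maximum _))
  , (λ L′ _ 𝒢′ _ _ f f-bijective f-≤⇔ 𝒢′≡f[𝒢] G _ _ →
      let open OrderIsomorphism L L′ f f-bijective f-≤⇔
      in Naturality.FY-natural 𝒢 𝒢′ (λ x∈𝒢 → Equivalence.from (𝒢′≡f[𝒢] _) (_ , x∈𝒢 , refl))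
           f-⊥̂ f-⊤̂ (minimum G) (maximum G))
  where
  open LatticeProperties L using (minimum; maximum)
  open BuildingSetProperties L 𝒢 using (nested-pair⇒∨∉)
  open FYProperties L 𝒢 using (module Coassociativity; module Commutation)
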